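{- Let $\vec M$ be a tree-oriented map and $T$ the spanning tree constructed by the procedure $\gamma$. Then the edges of $T$ are oriented from the root to the leaves (away from the root-vertex), and each edge not in $T$ is oriented so that its head precedes its tail around $T$.
   Context: A (rooted planar) map is a 2-cell embedding of a connected planar graph (loops and multiple edges allowed) in the oriented sphere up to orientation-preserving homeomorphism, with a distinguished half-edge, the root; its incident vertex is the root-vertex. In an oriented map each edge goes from origin (tail) to end (head); the root is considered a head. A positive cycle is a directed simple cycle having the root in its exterior region (the region on its right). An oriented map is tree-oriented if it has no positive cycle and every vertex can be reached from the root-vertex by a directed path. The tour of a spanning tree $T$ follows its border counterclockwise from the root back to the root; it induces a linear order ("precedes around $T$") on half-edges of edges not in $T$. Procedure $\gamma$: start with $T$ consisting of the root and the root-vertex; make the tour of $T$ starting from the root, and whenever the tail of an edge $e$ is encountered while its head has not been encountered yet, add $e$ (with its end) to $T$; continue the tour (following the border of $e$ if $e\in T$, crossing $e$ otherwise); stop at the root and return $T$ (this yields a spanning tree). -}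

module Defs where

open import Data.Nat using (ℕ; zero; suc; _+_; _<_; _≤ᵇ_)
open import Data.Fin using (Fin; toℕ; _≟_; inject₁; fromℕ)
open import Data.Bool using (Bool; true; false; not; _∧_; _∨_; if_then_else_)
open import Data.List using (List; []; _∷_; upTo; allFin)
open import Data.Bool.ListAction using (any; all)
open import Data.Nat.ListAction using (sum)
import Data.List as L
open import Data.Product using (Σ; ∃; ∃-syntax; _×_; _,_)
open import Data.Sum using (_⊎_)
open import Relation.Nullary using (¬_)
open import Relation.Nullary.Decidable using (⌊_⌋)
open import Relation.Binary.PropositionalEquality using (_≡_; _≢_)
open import Relation.Binary.Construct.Closure.ReflexiveTransitive using (Star)
open import Relation.Binary.Construct.Closure.Equivalence using (EqClosure)
open import Function using (_∘_)

iter : ∀ {A : Set} → (A → A) → ℕ → A → A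
iter f zero    x = x
iter f (suc n) x = f (iter f n x)

module _ {k : ℕ} (f : Fin k → Fin k) where
  -- h' lies in the orbit of h (for a permutation of Fin k, orbits have size ≤ k)
  inOrbitᵇ : Fin k → Fin k → Bool
  inOrbitᵇ h h' = any (λ n → ⌊ iter f n h ≟ h' ⌋) (upTo k)

  isOrbitMinᵇ : Fin k → Bool
  isOrbitMinᵇ h = all (λ h' → not (inOrbitᵇ h h') ∨ (toℕ h ≤ᵇ toℕ h')) (allFin k)

  cycles : ℕ
  cycles = sum (L.map (λ h → if isOrbitMinᵇ h then 1 else 0) (allFin k))

-- Rooted planar maps as rotation systems.
-- Half-edges: Fin k.  α: the fixed-point-free involution pairing the two
-- half-edges of an edge.  σ: counterclockwise successor of a half-edge
-- around its vertex (vertices = cycles of σ).  Faces = cycles of σ ∘ α.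
-- Planar (genus 0) = Euler's formula  V + F = E + 2.
-- The root is a corner: the corner following the half-edge  root
-- counterclockwise (between  root  and  σ root); the root-vertex is the
-- vertex of  root.

record Map : Set where
  field
    k     : ℕ
    α σ σ⁻¹ : Fin k → Fin k
    α-invol : ∀ h → α (α h) ≡ h
    α-nofix : ∀ h → α h ≢ h
    σσ⁻¹  : ∀ h → σ (σ⁻¹ h) ≡ h
    σ⁻¹σ  : ∀ h → σ⁻¹ (σ h) ≡ h
    connected : ∀ h h' → Star (λ x y → y ≡ σ x ⊎ y ≡ α x) h h'
    planar : cycles σ + cycles (σ ∘ α) ≡ cycles α + 2
    root  : Fin k

-- An oriented map: head? h = true iff h is the head (end) half-edge of its edge.
record OrientedMap : Set where
  field
    theMap : Map
  open Map theMap
  field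
    head? : Fin k → Bool
    head-α : ∀ h → head? (α h) ≡ not (head? h)

module _ (O : OrientedMap) where
  open OrientedMap O
  open Map theMap

  H : Set
  H = Fin k

  SameVertex : H → H → Set
  SameVertex h h' = ∃[ n ] iter σ n h ≡ h'

  -- one step of a directed walk (states are half-edges standing for their vertex):
  -- move around a vertex, or traverse an edge from its tail half-edge to its head.
  DStep : H → H → Set
  DStep h h' = SameVertex h h' ⊎ (head? h ≡ false × h' ≡ α h)

  -- directed simple cycle, given by the tail half-edges t 0, …, t ℓ of its edges
  record DirCycle : Set where
    field
      ℓ : ℕ
      t : Fin (suc ℓ) → H
      tails  : ∀ i → head? (t i) ≡ false
      consec : ∀ (i : Fin ℓ) → SameVertex (α (t (inject₁ i))) (t (Fin.suc i))
      close  : SameVertex (α (t (fromℕ ℓ))) (t Fin.zero)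
      simple : ∀ i j → SameVertex (t i) (t j) → i ≡ j

  InCycle : DirCycle → H → Set
  InCycle C x = ∃[ i ] (DirCycle.t C i ≡ x ⊎ DirCycle.t C i ≡ α x)

  -- Corners are indexed by half-edges: corner h lies between h and σ h.
  -- Two corners are adjacent in the complement of C if one moves from one to
  -- the other along an edge side (corner h ~ corner σ⁻¹(α h)), or around a
  -- vertex crossing the half-edge σ h of an edge not in C.
  CornerAdj : DirCycle → H → H → Set
  CornerAdj C h h' = (h' ≡ σ⁻¹ (α h)) ⊎ (h' ≡ σ h × ¬ InCycle C (σ h))

  -- positive cycle: the root corner lies in the region on the right of C
  -- (the right of the first edge, leaving its tail t 0, is the corner σ⁻¹ (t 0)).
  Positive : DirCycle → Set
  Positive C = EqClosure (CornerAdj C) root (σ⁻¹ (DirCycle.t C Fin.zero))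

  TreeOriented : Set
  TreeOriented = (∀ (C : DirCycle) → ¬ Positive C) × (∀ h → Star DStep root h)

  -- Edge sets are lists of half-edges; the edge of h is in T if h or α h is.
  edgeInᵇ : List H → H → Bool
  edgeInᵇ T h = any (λ x → ⌊ x ≟ h ⌋ ∨ ⌊ x ≟ α h ⌋) T

  elemᵇ : H → List H → Bool
  elemᵇ h L = any (λ x → ⌊ x ≟ h ⌋) L

  -- Procedure γ.  The tour position is the half-edge encountered next.
  record γState : Set where
    constructor st
    field
      pos  : H
      tree : List H
      seen : List H
      done : Bool

  γstep : γState → γState
  γstep (st p T S true)  = st p T S true
  γstep (st p T S false) =
    let T' = if not (head? p) ∧ not (elemᵇ (α p) S) then p ∷ T else T
        y  = if edgeInᵇ T' p then α p else p
    in st (σ y) T' (p ∷ S) ⌊ y ≟ root ⌋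

  γinit : γState
  γinit = st (σ root) [] [] false

  -- output of γ (the tour of a spanning tree takes exactly k steps;
  -- the state is frozen once the tour is back at the root)
  γ : List H
  γ = γState.tree (iter γstep k γinit)

  -- Tour of a tree T: i-th encountered half-edge.
  tourNext : List H → H → H
  tourNext T p = σ (if edgeInᵇ T p then α p else p)

  tourPos : List H → ℕ → H
  tourPos T i = iter (tourNext T) i (σ root)

  Precedes : List H → H → H → Set
  Precedes T h h' = ∃[ i ] ∃[ j ] (i < j × j < k × tourPos T i ≡ h × tourPos T j ≡ h'
                                  × (∀ l → l < j → tourPos T l ≢ h'))

  TStep : List H → H → H → Set
  TStep T h h' = SameVertex h h' ⊎ (head? h ≡ false × edgeInᵇ T h ≡ true × h' ≡ α h)

  -- every edge of T is oriented away from the root-vertex: its tail vertex is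
  -- reached from the root-vertex by a directed path in T
  OrientedAwayFromRoot : List H → Set
  OrientedAwayFromRoot T = ∀ t → head? t ≡ false → edgeInᵇ T t ≡ true → Star (TStep T) root t

  NonTreeHeadFirst : List H → Set
  NonTreeHeadFirst T = ∀ h → edgeInᵇ T h ≡ false → head? h ≡ true → Precedes T h (α h)

-- γ is a depth-first search steered by the tour. The tree edges leading from the root-vertex
-- to the current vertex form a stack, and an edge is added to T only if the vertex of its head
-- has never been touched: otherwise that vertex is on the stack, and the stack edges above it
-- together with the new edge form a directed cycle. The tour reached the new edge from the
-- root corner without crossing tree edges or edges not yet met, so the root corner lies to the
-- right of this cycle, i.e. the cycle is positive. Hence every vertex is entered exactly once,
-- through a tree edge oriented away from the root-vertex, and is left only after all its
-- half-edges have been met. Since every vertex is reachable by a directed path, all half-edges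
-- are met before the search returns to the root, and the run of γ is then precisely the tour
-- of T. Finally, an edge not in T was not added when its tail was met, so its head had been
-- met earlier.

module Submission where

open import Defs
open import Data.Nat using (ℕ; zero; suc; _+_; _*_; _∸_; _≤_; _<_; _<?_; z≤n; s≤s; s≤s⁻¹)
open import Data.Nat.Properties
  using ( ≤-refl; ≤-reflexive; ≤-trans; <⇒≤; ≮⇒≥; <-irrefl; <-cmp; n<1+n; n≤1+n; m<n⇒m<1+n
        ; m≤n⇒m≤1+n; m≤n⇒m<n∨m≡n; m≤n+m; +-suc; m≤n⇒∃[o]m+o≡n; m∸n+n≡m )
open import Data.Nat.DivMod using (_%_; _/_; m≡m%n+[m/n]*n; m%n<n)
open import Data.Bool using (true; false; not; _∨_; if_then_else_)
open import Data.Bool.Properties using (∨-comm)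
open import Data.Fin as Fin using (Fin; toℕ; _≟_; inject₁; fromℕ)
open import Data.Fin.Properties using (pigeonhole; toℕ≤pred[n])
open import Data.List using (List; []; _∷_; _∷ʳ_; [_]; lookup; length)
open import Data.List.Relation.Unary.All as All using (All; []; _∷_)
open import Data.List.Relation.Unary.All.Properties using (++⁺)
open import Data.List.Relation.Unary.Any using (Any; here; there)
open import Data.List.Relation.Unary.AllPairs as AllPairs using (AllPairs; []; _∷_)
import Data.List.Relation.Unary.AllPairs.Properties as AllPairs
open import Data.List.Membership.Propositional using (_∈_; _∉_; find; lose)
open import Data.List.Membership.Propositional.Properties using (∈-lookup)
import Data.List.Membership.DecPropositional as DecMembership
open import Data.Product as Product using (∃-syntax; _×_; _,_; proj₁; proj₂)
open import Data.Sum as Sum using (_⊎_; inj₁; inj₂)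
open import Data.Unit using (⊤; tt)
open import Data.Empty using (⊥; ⊥-elim)
open import Function.Base using (_∘_; id)
open import Function.Definitions using (Injective)
open import Relation.Binary.Definitions using (tri<; tri≈; tri>)
open import Relation.Nullary using (¬_; yes; no)
open import Relation.Nullary.Decidable using (⌊_⌋)
open import Relation.Unary using (Decidable)
open import Relation.Binary.PropositionalEquality hiding ([_])
open import Relation.Binary.Construct.Closure.ReflexiveTransitive using (Star; ε; _◅_; _◅◅_; gmap; foldl)
open import Relation.Binary.Construct.Closure.Symmetric using (fwd; bwd)
open import Relation.Binary.Construct.Closure.Equivalence using (EqClosure)

module _ {A : Set} (f : A → A) where

  iter-+ : ∀ m n x → iter f (m + n) x ≡ iter f m (iter f n x)
  iter-+ zero    n x = refl
  iter-+ (suc m) n x = cong f (iter-+ m n x)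

  iter-injective : Injective _≡_ _≡_ f → ∀ n {x y} → iter f n x ≡ iter f n y → x ≡ y
  iter-injective f-inj zero    eq = eq
  iter-injective f-inj (suc n) eq = iter-injective f-inj n (f-inj eq)

≤-upward : ∀ {P : ℕ → Set} → (∀ n → P n → P (suc n)) → ∀ {m n} → m ≤ n → P m → P n
≤-upward next {n = zero}  z≤n   pm = pm
≤-upward next {n = suc n} m≤1+n pm with m≤n⇒m<n∨m≡n m≤1+n
... | inj₁ m<1+n = next n (≤-upward next (s≤s⁻¹ m<1+n) pm)
... | inj₂ refl  = pm

module _ {P : ℕ → Set} (P? : Decidable P) where

  least-or-none : ∀ m → (∃[ n ] P n × (∀ {j} → j < n → ¬ P j)) ⊎ (∀ {j} → j < m → ¬ P j)
  least-or-none zero = inj₂ λ ()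
  least-or-none (suc m) with least-or-none m
  ... | inj₁ found = inj₁ found
  ... | inj₂ none with P? m
  ...   | yes pm = inj₁ (m , pm , none)
  ...   | no ¬pm = inj₂ below
    where
    below : ∀ {j} → j < suc m → ¬ P j
    below j<1+m with m≤n⇒m<n∨m≡n (s≤s⁻¹ j<1+m)
    ... | inj₁ j<m  = none j<m
    ... | inj₂ refl = ¬pm

  least : ∀ {m} → P m → ∃[ n ] P n × (∀ {j} → j < n → ¬ P j)
  least {m} pm with least-or-none (suc m)
  ... | inj₁ found = found
  ... | inj₂ none  = ⊥-elim (none (n<1+n m) pm)

-- Orbits of an injective map on a finite set

module Orbit {n : ℕ} (f : Fin n → Fin n) (f-injective : Injective _≡_ _≡_ f) where

  infix 4 _∼_ _≁_

  _∼_ : Fin n → Fin n → Set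
  a ∼ b = ∃[ m ] iter f m a ≡ b

  _≁_ : Fin n → Fin n → Set
  a ≁ b = ¬ a ∼ b

  ∼-refl : ∀ {a} → a ∼ a
  ∼-refl = 0 , refl

  ∼-step : ∀ a → a ∼ f a
  ∼-step a = 1 , refl

  ∼-trans : ∀ {a b c} → a ∼ b → b ∼ c → a ∼ c
  ∼-trans {a} (m , refl) (l , refl) = l + m , iter-+ f l m a

  iter-cancel : ∀ i d {a} → iter f i a ≡ iter f (i + d) a → a ≡ iter f d a
  iter-cancel i d {a} eq = iter-injective f f-injective i (trans eq (iter-+ f i d a))

  returns : ∀ a → ∃[ m ] iter f (suc m) a ≡ a
  returns a with pigeonhole (n<1+n n) (λ i → iter f (toℕ i) a)
  ... | i , j , i<j , fⁱa≡fʲa with d , 1+i+d≡j ← m≤n⇒∃[o]m+o≡n i<j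
    = d , sym (iter-cancel (toℕ i) (suc d) (trans fⁱa≡fʲa (cong (λ m → iter f m a) j≡i+1+d)))
    where
    j≡i+1+d : toℕ j ≡ toℕ i + suc d
    j≡i+1+d = trans (sym 1+i+d≡j) (sym (+-suc (toℕ i) d))

  private
    firstReturn : ∀ a → ∃[ m ] iter f (suc m) a ≡ a × (∀ {j} → j < m → iter f (suc j) a ≢ a)
    firstReturn a with m , fᵐ⁺¹a≡a ← returns a = least (λ m → iter f (suc m) a ≟ a) {m} fᵐ⁺¹a≡a

  ord : Fin n → ℕ
  ord a = suc (proj₁ (firstReturn a))

  iter-ord : ∀ a → iter f (ord a) a ≡ a
  iter-ord a = proj₁ (proj₂ (firstReturn a))

  iter-≢-below-ord : ∀ a {j} → suc j < ord a → iter f (suc j) a ≢ a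
  iter-≢-below-ord a 1+j<ord = proj₂ (proj₂ (firstReturn a)) (s≤s⁻¹ 1+j<ord)

  iter-distinct-below-ord : ∀ a {i j} → i < j → j < ord a → iter f (suc i) a ≢ iter f (suc j) a
  iter-distinct-below-ord a {i} {j} i<j j<ord eq with d , 1+i+d≡j ← m≤n⇒∃[o]m+o≡n i<j
    = iter-≢-below-ord a 1+d<ord
        (sym (iter-cancel (suc i) (suc d) (trans eq (cong (λ m → iter f m a) 1+j≡1+i+1+d))))
    where
    1+d<ord : suc d < ord a
    1+d<ord = ≤-trans (s≤s (subst (suc d ≤_) 1+i+d≡j (s≤s (m≤n+m d i)))) j<ord
    1+j≡1+i+1+d : suc j ≡ suc i + suc d
    1+j≡1+i+1+d = trans (cong suc (sym 1+i+d≡j)) (sym (+-suc (suc i) d))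

  iter-injective-below-ord : ∀ a {i j} → i < ord a → j < ord a → iter f (suc i) a ≡ iter f (suc j) a → i ≡ j
  iter-injective-below-ord a {i} {j} i<ord j<ord eq with <-cmp i j
  ... | tri< i<j _ _ = ⊥-elim (iter-distinct-below-ord a i<j j<ord eq)
  ... | tri≈ _ i≡j _ = i≡j
  ... | tri> _ _ j<i = ⊥-elim (iter-distinct-below-ord a j<i i<ord (sym eq))

  first-return-is-ord : ∀ a {c} → c < ord a → iter f (suc c) a ≡ a → suc c ≡ ord a
  first-return-is-ord a c<ord fᶜ⁺¹a≡a =
    cong suc (iter-injective-below-ord a c<ord ≤-refl (trans fᶜ⁺¹a≡a (sym (iter-ord a))))

  iter-≢⇒<ord : ∀ a {c} → c < ord a → iter f (suc c) a ≢ a → suc c < ord a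
  iter-≢⇒<ord a c<ord fᶜ⁺¹a≢a with m≤n⇒m<n∨m≡n c<ord
  ... | inj₁ 1+c<ord = 1+c<ord
  ... | inj₂ 1+c≡ord = ⊥-elim (fᶜ⁺¹a≢a (trans (cong (λ m → iter f m a) 1+c≡ord) (iter-ord a)))

  iter-ord-multiple : ∀ a q → iter f (q * ord a) a ≡ a
  iter-ord-multiple a zero    = refl
  iter-ord-multiple a (suc q) = begin
    iter f (ord a + q * ord a) a          ≡⟨ iter-+ f (ord a) (q * ord a) a ⟩
    iter f (ord a) (iter f (q * ord a) a) ≡⟨ cong (iter f (ord a)) (iter-ord-multiple a q) ⟩
    iter f (ord a) a                      ≡⟨ iter-ord a ⟩
    a                                     ∎
    where open ≡-Reasoning

  iter-mod-ord : ∀ a m → iter f m a ≡ iter f (m % ord a) a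
  iter-mod-ord a m = begin
    iter f m a                                        ≡⟨ cong (λ l → iter f l a) (m≡m%n+[m/n]*n m (ord a)) ⟩
    iter f (m % ord a + m / ord a * ord a) a          ≡⟨ iter-+ f (m % ord a) (m / ord a * ord a) a ⟩
    iter f (m % ord a) (iter f (m / ord a * ord a) a) ≡⟨ cong (iter f (m % ord a))
                                                               (iter-ord-multiple a (m / ord a)) ⟩
    iter f (m % ord a) a                              ∎
    where open ≡-Reasoning

  orbit-covered : ∀ {a b} → a ∼ b → ∃[ i ] i < ord a × iter f (suc i) a ≡ b
  orbit-covered {a} (m , refl) = within (m % ord a) (m%n<n m (ord a)) (sym (iter-mod-ord a m))
    where
    within : ∀ r → r < ord a → iter f r a ≡ iter f m a → ∃[ i ] i < ord a × iter f (suc i) a ≡ iter f m a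
    within zero    _       eq = _ , ≤-refl , trans (iter-ord a) eq
    within (suc i) 1+i<ord eq = i , ≤-trans (n≤1+n (suc i)) 1+i<ord , eq

  ∼-sym : ∀ {a b} → a ∼ b → b ∼ a
  ∼-sym {a} a∼b with i , i<ord , refl ← orbit-covered a∼b = ord a ∸ suc i , (begin
    iter f (ord a ∸ suc i) (iter f (suc i) a) ≡⟨ iter-+ f (ord a ∸ suc i) (suc i) a ⟨
    iter f (ord a ∸ suc i + suc i) a          ≡⟨ cong (λ l → iter f l a) (m∸n+n≡m i<ord) ⟩
    iter f (ord a) a                          ≡⟨ iter-ord a ⟩
    a                                         ∎)
    where open ≡-Reasoning

module Traversal (O : OrientedMap) where
  open OrientedMap O
  open Map theMap
  open DecMembership (_≟_ {k}) using (_∈?_)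

  σ-injective : Injective _≡_ _≡_ σ
  σ-injective {a} {b} σa≡σb = trans (sym (σ⁻¹σ a)) (trans (cong σ⁻¹ σa≡σb) (σ⁻¹σ b))

  open Orbit σ σ-injective public

  Tail Head : Fin k → Set
  Tail h = head? h ≡ false
  Head h = head? h ≡ true

  tail-or-head : ∀ h → Tail h ⊎ Head h
  tail-or-head h with head? h
  ... | false = inj₁ refl
  ... | true  = inj₂ refl

  tail≢head : ∀ {h} → Tail h → Head h → ⊥
  tail≢head tail head with () ← trans (sym tail) head

  head-of-α : ∀ {h} → Tail h → Head (α h)
  head-of-α {h} tail = trans (head-α h) (cong not tail)

  tail-of-α : ∀ {h} → Head h → Tail (α h)
  tail-of-α {h} head = trans (head-α h) (cong not head)

  SameEdge : Fin k → Fin k → Set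
  SameEdge y h = y ≡ h ⊎ y ≡ α h

  InTree : List (Fin k) → Fin k → Set
  InTree T h = edgeInᵇ O T h ≡ true

  inTree-here : ∀ p T → InTree (p ∷ T) p
  inTree-here p T with p ≟ p
  ... | yes _  = refl
  ... | no p≢p = ⊥-elim (p≢p refl)

  inTree-there : ∀ p {T h} → InTree T h → InTree (p ∷ T) h
  inTree-there p {T} {h} h∈T with p ≟ h | p ≟ α h
  ... | yes _ | _     = refl
  ... | no _  | yes _ = refl
  ... | no _  | no _  = h∈T

  inTree-∷⁻ : ∀ {p T h} → InTree (p ∷ T) h → SameEdge p h ⊎ InTree T h
  inTree-∷⁻ {p} {T} {h} h∈p∷T with p ≟ h | p ≟ α h
  ... | yes p≡h | _        = inj₁ (inj₁ p≡h)
  ... | no _    | yes p≡αh = inj₁ (inj₂ p≡αh)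
  ... | no _    | no _     = inj₂ h∈p∷T

  edgeIn-∷-≢ : ∀ {p h} T → p ≢ h → p ≢ α h → edgeInᵇ O (p ∷ T) h ≡ edgeInᵇ O T h
  edgeIn-∷-≢ {p} {h} T p≢h p≢αh with p ≟ h | p ≟ α h
  ... | yes p≡h | _        = ⊥-elim (p≢h p≡h)
  ... | no _    | yes p≡αh = ⊥-elim (p≢αh p≡αh)
  ... | no _    | no _     = refl

  edgeIn-α : ∀ T h → edgeInᵇ O T (α h) ≡ edgeInᵇ O T h
  edgeIn-α []      h = refl
  edgeIn-α (x ∷ T) h = cong₂ _∨_ swapped (edgeIn-α T h)
    where
    swapped : (⌊ x ≟ α h ⌋ ∨ ⌊ x ≟ α (α h) ⌋) ≡ (⌊ x ≟ h ⌋ ∨ ⌊ x ≟ α h ⌋)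
    swapped rewrite α-invol h = ∨-comm ⌊ x ≟ α h ⌋ ⌊ x ≟ h ⌋

  inTree-α : ∀ {T h} → InTree T h → InTree T (α h)
  inTree-α {T} {h} h∈T = trans (edgeIn-α T h) h∈T

  inTree-sameEdge : ∀ {T y h} → InTree T y → SameEdge y h → InTree T h
  inTree-sameEdge y∈T (inj₁ refl) = y∈T
  inTree-sameEdge {T} {h = h} y∈T (inj₂ refl) = trans (sym (edgeIn-α T h)) y∈T

  ∈⇒elemᵇ : ∀ {h S} → h ∈ S → elemᵇ O h S ≡ true
  ∈⇒elemᵇ {h} (here refl) with h ≟ h
  ... | yes _  = refl
  ... | no h≢h = ⊥-elim (h≢h refl)
  ∈⇒elemᵇ {h} {x ∷ S} (there h∈S) with x ≟ h
  ... | yes _ = refl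
  ... | no _  = ∈⇒elemᵇ h∈S

  elemᵇ⇒∈ : ∀ {h} S → elemᵇ O h S ≡ true → h ∈ S
  elemᵇ⇒∈ {h} (x ∷ S) eq with x ≟ h
  ... | yes refl = here refl
  ... | no _     = there (elemᵇ⇒∈ S eq)

  elemᵇ-false⇒∉ : ∀ {h S} → elemᵇ O h S ≡ false → h ∉ S
  elemᵇ-false⇒∉ eq h∈S with () ← trans (sym (∈⇒elemᵇ h∈S)) eq

  Skipped : List (Fin k) → Fin k → Set
  Skipped S p = Head p ⊎ α p ∈ S

  skipped-tail : ∀ {S p} → Skipped S p → Tail p → α p ∈ S
  skipped-tail (inj₁ head-p) tail-p = ⊥-elim (tail≢head tail-p head-p)
  skipped-tail (inj₂ αp∈S)   _      = αp∈S

  data Step (p : Fin k) (T S : List (Fin k)) : γState O → Set where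
    cross  : edgeInᵇ O T p ≡ false → Skipped S p → Step p T S (st (σ p) T (p ∷ S) ⌊ p ≟ root ⌋)
    push   : Tail p → α p ∉ S → Step p T S (st (σ (α p)) (p ∷ T) (p ∷ S) ⌊ α p ≟ root ⌋)
    follow : InTree T p → Skipped S p → Step p T S (st (σ (α p)) T (p ∷ S) ⌊ α p ≟ root ⌋)

  skip-step : ∀ {p T S} → Skipped S p →
              Step p T S (st (σ (if edgeInᵇ O T p then α p else p)) T (p ∷ S)
                             ⌊ (if edgeInᵇ O T p then α p else p) ≟ root ⌋)
  skip-step {p} {T} skipped with edgeInᵇ O T p in p∈?T
  ... | true  = follow p∈?T skipped
  ... | false = cross p∈?T skipped

  step : ∀ p T S → Step p T S (γstep O (st p T S false))
  step p T S with head? p in hp | elemᵇ O (α p) S in αp∈?S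
  ... | false | false rewrite inTree-here p T = push hp (elemᵇ-false⇒∉ αp∈?S)
  ... | false | true  = skip-step (inj₂ (elemᵇ⇒∈ S αp∈?S))
  ... | true  | _     = skip-step (inj₁ hp)

  -- Position i around the vertex of e is the half-edge iter σ (suc i) e, for i < ord e;
  -- the last position, ord e ∸ 1, is e itself.
  SeenPrefix : List (Fin k) → Fin k → ℕ → Set
  SeenPrefix S e c = ∀ {i} → i < ord e → (iter σ (suc i) e ∈ S → i < c) × (i < c → iter σ (suc i) e ∈ S)

  FirstUnseenAfter : List (Fin k) → Fin k → Fin k → Set
  FirstUnseenAfter S e p = ∃[ c ] c < ord e × iter σ (suc c) e ≡ p × SeenPrefix S e c

  LastSeenAfter : List (Fin k) → Fin k → Fin k → Set
  LastSeenAfter S e x = ∃[ c ] c < ord e × iter σ (suc c) e ≡ x × SeenPrefix S e (suc c)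

  seenPrefix-∷ : ∀ {S e c q} → SeenPrefix S e c → e ≁ q → SeenPrefix (q ∷ S) e c
  seenPrefix-∷ {S} {e} {c} {q} prefix e≁q {i} i<ord = seen⇒<c , <c⇒seen
    where
    seen⇒<c : iter σ (suc i) e ∈ q ∷ S → i < c
    seen⇒<c (here eq)   = ⊥-elim (e≁q (suc i , eq))
    seen⇒<c (there i∈S) = proj₁ (prefix i<ord) i∈S
    <c⇒seen : i < c → iter σ (suc i) e ∈ q ∷ S
    <c⇒seen i<c = there (proj₂ (prefix i<ord) i<c)

  seenPrefix-next : ∀ {S e c} → SeenPrefix S e c → c < ord e → SeenPrefix (iter σ (suc c) e ∷ S) e (suc c)
  seenPrefix-next {S} {e} {c} prefix c<ord {i} i<ord = seen⇒≤c , ≤c⇒seen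
    where
    seen⇒≤c : iter σ (suc i) e ∈ iter σ (suc c) e ∷ S → i < suc c
    seen⇒≤c (here eq)   = s≤s (≤-reflexive (iter-injective-below-ord e i<ord c<ord eq))
    seen⇒≤c (there i∈S) = m≤n⇒m≤1+n (proj₁ (prefix i<ord) i∈S)
    ≤c⇒seen : i < suc c → iter σ (suc i) e ∈ iter σ (suc c) e ∷ S
    ≤c⇒seen i<1+c with m≤n⇒m<n∨m≡n (s≤s⁻¹ i<1+c)
    ... | inj₁ i<c  = there (proj₂ (prefix i<ord) i<c)
    ... | inj₂ refl = here refl

  firstUnseen-∉ : ∀ {S e p} → FirstUnseenAfter S e p → p ∉ S
  firstUnseen-∉ (c , c<ord , refl , prefix) p∈S = <-irrefl refl (proj₁ (prefix c<ord) p∈S)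

  firstUnseen-∷ : ∀ {S e p q} → FirstUnseenAfter S e p → e ≁ q → FirstUnseenAfter (q ∷ S) e p
  firstUnseen-∷ (c , c<ord , eq , prefix) e≁q = c , c<ord , eq , seenPrefix-∷ prefix e≁q

  lastSeen-∷ : ∀ {S e x q} → LastSeenAfter S e x → e ≁ q → LastSeenAfter (q ∷ S) e x
  lastSeen-∷ (c , c<ord , eq , prefix) e≁q = c , c<ord , eq , seenPrefix-∷ prefix e≁q

  firstUnseen-fresh : ∀ {S e} → (∀ {h} → e ∼ h → h ∉ S) → FirstUnseenAfter S e (σ e)
  firstUnseen-fresh fresh =
    0 , s≤s z≤n , refl , λ {i} _ → (λ i∈S → ⊥-elim (fresh (suc i , refl) i∈S)) , λ ()

  firstUnseen-σ : ∀ {S e p} → FirstUnseenAfter S e p → p ≢ e → FirstUnseenAfter (p ∷ S) e (σ p)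
  firstUnseen-σ {e = e} (c , c<ord , refl , prefix) p≢e =
    suc c , iter-≢⇒<ord e c<ord p≢e , refl , seenPrefix-next prefix c<ord

  lastSeen-of-firstUnseen : ∀ {S e p} → FirstUnseenAfter S e p → LastSeenAfter (p ∷ S) e p
  lastSeen-of-firstUnseen (c , c<ord , refl , prefix) = c , c<ord , refl , seenPrefix-next prefix c<ord

  firstUnseen-of-lastSeen : ∀ {S e x} → LastSeenAfter S e x → x ≢ e → FirstUnseenAfter S e (σ x)
  firstUnseen-of-lastSeen {e = e} (c , c<ord , refl , prefix) x≢e =
    suc c , iter-≢⇒<ord e c<ord x≢e , refl , prefix

  lastSeen-return : ∀ {S e} → LastSeenAfter S e e → ∀ {h} → e ∼ h → h ∈ S
  lastSeen-return {e = e} (c , c<ord , fᶜ⁺¹e≡e , prefix) e∼h with i , i<ord , refl ← orbit-covered e∼h =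
    proj₂ (prefix i<ord) (subst (i <_) (sym (first-return-is-ord e c<ord fᶜ⁺¹e≡e)) i<ord)

  firstUnseen-return : ∀ {S e} → FirstUnseenAfter S e e → ∀ {h} → e ∼ h → h ∈ e ∷ S
  firstUnseen-return first = lastSeen-return (lastSeen-of-firstUnseen first)

  -- Directed cycles and the corners on their right

  RootCornerPath : DirCycle O → Fin k → Set
  RootCornerPath C = EqClosure (CornerAdj O C) root

  corner-cross : ∀ C {p} → ¬ InCycle O C p → RootCornerPath C (σ⁻¹ p) → RootCornerPath C (σ⁻¹ (σ p))
  corner-cross C {p} p∉C path = subst (RootCornerPath C) (sym (σ⁻¹σ p))
    (path ◅◅ fwd (inj₂ (sym (σσ⁻¹ p) , subst (λ h → ¬ InCycle O C h) (sym (σσ⁻¹ p)) p∉C)) ◅ ε)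

  corner-follow : ∀ C {p} → RootCornerPath C (σ⁻¹ p) → RootCornerPath C (σ⁻¹ (σ (α p)))
  corner-follow C {p} path = subst (RootCornerPath C) (sym (σ⁻¹σ (α p)))
    (path ◅◅ bwd (inj₁ (cong σ⁻¹ (sym (α-invol p)))) ◅ ε)

  Walk : Fin k → List (Fin k) → Fin k → Set
  Walk v []       w = v ∼ w
  Walk v (y ∷ ys) w = v ∼ y × Walk (α y) ys w

  walk-∷ʳ : ∀ {v w x} ys → Walk v ys w → w ∼ x → Walk v (ys ∷ʳ x) (α x)
  walk-∷ʳ []       v∼w          w∼x = ∼-trans v∼w w∼x , ∼-refl
  walk-∷ʳ (y ∷ ys) (v∼y , walk) w∼x = v∼y , walk-∷ʳ ys walk w∼x

  walk-extend : ∀ {v w w′} ys → Walk v ys w → w ∼ w′ → Walk v ys w′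
  walk-extend []       v∼w          w∼w′ = ∼-trans v∼w w∼w′
  walk-extend (y ∷ ys) (v∼y , walk) w∼w′ = v∼y , walk-extend ys walk w∼w′

  walk-consecutive : ∀ a xs {w} → Walk (α a) xs w → ∀ i → α (lookup (a ∷ xs) (inject₁ i)) ∼ lookup xs i
  walk-consecutive a (y ∷ ys) (αa∼y , walk) Fin.zero    = αa∼y
  walk-consecutive a (y ∷ ys) (αa∼y , walk) (Fin.suc i) = walk-consecutive y ys walk i

  walk-last : ∀ a xs {w} → Walk (α a) xs w → α (lookup (a ∷ xs) (fromℕ (length xs))) ∼ w
  walk-last a []       walk       = walk
  walk-last a (y ∷ ys) (_ , walk) = walk-last y ys walk

  lookup-≁-injective : ∀ xs → AllPairs _≁_ xs → ∀ i j → lookup xs i ∼ lookup xs j → i ≡ j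
  lookup-≁-injective (x ∷ xs) _           Fin.zero    Fin.zero    _   = refl
  lookup-≁-injective (x ∷ xs) (x≁xs ∷ _)  Fin.zero    (Fin.suc j) x∼y =
    ⊥-elim (All.lookup x≁xs (∈-lookup j) x∼y)
  lookup-≁-injective (x ∷ xs) (x≁xs ∷ _)  (Fin.suc i) Fin.zero    y∼x =
    ⊥-elim (All.lookup x≁xs (∈-lookup i) (∼-sym y∼x))
  lookup-≁-injective (x ∷ xs) (_ ∷ xs≁xs) (Fin.suc i) (Fin.suc j) y∼z =
    cong Fin.suc (lookup-≁-injective xs xs≁xs i j y∼z)

  cycleOfWalk : ∀ a xs → All Tail (a ∷ xs) → Walk (α a) xs a → AllPairs _≁_ (a ∷ xs) → DirCycle O
  cycleOfWalk a xs tails walk distinct = record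
    { ℓ      = length xs
    ; t      = lookup (a ∷ xs)
    ; tails  = λ i → All.lookup tails (∈-lookup i)
    ; consec = walk-consecutive a xs walk
    ; close  = walk-last a xs walk
    ; simple = lookup-≁-injective (a ∷ xs) distinct
    }

  inCycle-cycleOfWalk : ∀ {a xs} tails walk distinct {h} → InCycle O (cycleOfWalk a xs tails walk distinct) h →
                        ∃[ y ] y ∈ a ∷ xs × SameEdge y h
  inCycle-cycleOfWalk {a} {xs} _ _ _ (i , same) = lookup (a ∷ xs) i , ∈-lookup i , same

  -- The stack of γ

  -- A stack lists the tail half-edges of the tree edges leading from the root-vertex to the
  -- current vertex, top first; entry s is the half-edge through which the current vertex was
  -- entered, and root for the root-vertex.
  entry : List (Fin k) → Fin k
  entry []      = root
  entry (x ∷ _) = α x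

  entries : List (Fin k) → List (Fin k)
  entries []      = [ root ]
  entries (x ∷ s) = α x ∷ entries s

  lowerEntries : List (Fin k) → List (Fin k)
  lowerEntries []      = []
  lowerEntries (_ ∷ s) = entries s

  entry-∈-entries : ∀ s → entry s ∈ entries s
  entry-∈-entries []      = here refl
  entry-∈-entries (_ ∷ _) = here refl

  root-∈-entries : ∀ s → root ∈ entries s
  root-∈-entries []      = here refl
  root-∈-entries (_ ∷ s) = there (root-∈-entries s)

  α-∈-entries : ∀ {x s} → x ∈ s → α x ∈ entries s
  α-∈-entries (here refl) = here refl
  α-∈-entries (there x∈s) = there (α-∈-entries x∈s)

  entries⇒lowerEntries : ∀ {P : Fin k → Set} s → All P (entries s) → All P (lowerEntries s)
  entries⇒lowerEntries []      _        = []
  entries⇒lowerEntries (_ ∷ _) (_ ∷ Ps) = Ps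

  tail-≢-entry : ∀ {x} stk → All Tail stk → Tail x → x ≢ root → x ≢ entry stk
  tail-≢-entry []      _            _      x≢root        = x≢root
  tail-≢-entry (y ∷ _) (tail-y ∷ _) tail-x _      refl = tail≢head tail-x (head-of-α tail-y)

  lowerEntries-≁ : ∀ {q} stk → AllPairs _≁_ (entries stk) → entry stk ∼ q → All (_≁ q) (lowerEntries stk)
  lowerEntries-≁ []      _              _    = []
  lowerEntries-≁ (x ∷ s) (αx≁lower ∷ _) αx∼q =
    All.map (λ αx≁e e∼q → αx≁e (∼-trans αx∼q (∼-sym e∼q))) αx≁lower

  root-below : ∀ {x s} → AllPairs _≁_ (entries (x ∷ s)) → α x ≁ root
  root-below {s = s} (αx≁s ∷ _) = All.lookup αx≁s (root-∈-entries s)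

  Linked : List (Fin k) → Set
  Linked []      = ⊤
  Linked (x ∷ s) = entry s ∼ x × Linked s

  SuspendedArcs : List (Fin k) → List (Fin k) → Set
  SuspendedArcs S []      = ⊤
  SuspendedArcs S (x ∷ s) = LastSeenAfter S (entry s) x × SuspendedArcs S s

  suspendedArcs-∷ : ∀ {S q} stk → SuspendedArcs S stk → All (_≁ q) (lowerEntries stk) →
                    SuspendedArcs (q ∷ S) stk
  suspendedArcs-∷ []      _            _       = tt
  suspendedArcs-∷ (x ∷ s) (arc , arcs) lower≁q =
    lastSeen-∷ arc (All.lookup lower≁q (entry-∈-entries s))
    , suspendedArcs-∷ s arcs (entries⇒lowerEntries s lower≁q)

  Visited : List (Fin k) → Fin k → Set
  Visited V e = ∃[ g ] g ∈ V × g ∼ e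

  visited-∷ : ∀ {V q e} → Visited V e → Visited (q ∷ V) e
  visited-∷ (g , g∈V , g∼e) = g , there g∈V , g∼e

  record StackInv (p : Fin k) (S stk : List (Fin k)) : Set where
    field
      atTop      : entry stk ∼ p
      linked     : Linked stk
      tails      : All Tail stk
      distinct   : AllPairs _≁_ (entries stk)
      visited    : All (Visited (p ∷ S)) (entries stk)
      current    : FirstUnseenAfter S (entry stk) p
      suspended  : SuspendedArcs S stk
      unfinished : ∀ {g h} → g ∈ p ∷ S → h ∉ S → g ∼ h → Any (_∼ h) (entries stk)

  returned-complete : ∀ {p S stk} → StackInv p S stk → entry stk ≡ p →
                      ∀ {h} → entry stk ∼ h → h ∈ p ∷ S
  returned-complete I refl = firstUnseen-return (StackInv.current I)

  stack-init : StackInv (σ root) [] []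
  stack-init = record
    { atTop      = ∼-step root
    ; linked     = tt
    ; tails      = []
    ; distinct   = [] ∷ []
    ; visited    = (σ root , here refl , ∼-sym (∼-step root)) ∷ []
    ; current    = firstUnseen-fresh (λ _ ())
    ; suspended  = tt
    ; unfinished = λ { (here refl) _ g∼h → here (∼-trans (∼-step root) g∼h) }
    }

  stack-cross : ∀ {p S stk} → StackInv p S stk → p ∉ entries stk → StackInv (σ p) (p ∷ S) stk
  stack-cross {p} {S} {stk} I p∉entries = record
    { atTop      = ∼-trans atTop (∼-step p)
    ; linked     = linked
    ; tails      = tails
    ; distinct   = distinct
    ; visited    = All.map visited-∷ visited
    ; current    = firstUnseen-σ current λ { refl → p∉entries (entry-∈-entries stk) }
    ; suspended  = suspendedArcs-∷ stk suspended (lowerEntries-≁ stk distinct atTop)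
    ; unfinished = unfinished′
    }
    where
    open StackInv I
    unfinished′ : ∀ {g h} → g ∈ σ p ∷ p ∷ S → h ∉ p ∷ S → g ∼ h → Any (_∼ h) (entries stk)
    unfinished′ (here refl) h∉ g∼h = unfinished (here refl) (h∉ ∘ there) (∼-trans (∼-step p) g∼h)
    unfinished′ (there g∈)  h∉ g∼h = unfinished g∈ (h∉ ∘ there) g∼h

  stack-push : ∀ {p S stk} → StackInv p S stk → Tail p → (∀ {g} → g ∈ p ∷ S → g ≁ α p) →
               StackInv (σ (α p)) (p ∷ S) (p ∷ stk)
  stack-push {p} {S} {stk} I tail-p fresh = record
    { atTop      = ∼-step (α p)
    ; linked     = atTop , linked
    ; tails      = tail-p ∷ tails
    ; distinct   = All.map (λ (g , g∈ , g∼e) αp∼e → fresh g∈ (∼-trans g∼e (∼-sym αp∼e))) visited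
                 ∷ distinct
    ; visited    = (σ (α p) , here refl , ∼-sym (∼-step (α p))) ∷ All.map visited-∷ visited
    ; current    = firstUnseen-fresh λ αp∼h h∈ → fresh h∈ (∼-sym αp∼h)
    ; suspended  = lastSeen-of-firstUnseen current , suspendedArcs-∷ stk suspended (lowerEntries-≁ stk distinct atTop)
    ; unfinished = unfinished′
    }
    where
    open StackInv I
    unfinished′ : ∀ {g h} → g ∈ σ (α p) ∷ p ∷ S → h ∉ p ∷ S → g ∼ h → Any (_∼ h) (entries (p ∷ stk))
    unfinished′ (here refl) _  g∼h = here (∼-trans (∼-step (α p)) g∼h)
    unfinished′ (there g∈)  h∉ g∼h = there (unfinished g∈ (h∉ ∘ there) g∼h)

  stack-pop : ∀ {p S rest} → StackInv p S (α p ∷ rest) → α p ∈ S → α p ≢ root →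
              StackInv (σ (α p)) (p ∷ S) rest
  stack-pop {p} {S} {rest} I αp∈S αp≢root = record
    { atTop      = ∼-trans (proj₁ linked) (∼-step (α p))
    ; linked     = proj₂ linked
    ; tails      = All.tail tails
    ; distinct   = AllPairs.tail distinct
    ; visited    = All.map visited-∷ (All.tail visited)
    ; current    = firstUnseen-∷ (firstUnseen-of-lastSeen (proj₁ suspended) αp≢entry)
                                 (All.lookup rest≁p (entry-∈-entries rest))
    ; suspended  = suspendedArcs-∷ rest (proj₂ suspended) (entries⇒lowerEntries rest rest≁p)
    ; unfinished = unfinished′
    }
    where
    open StackInv I
    αp≢entry : α p ≢ entry rest
    αp≢entry = tail-≢-entry rest (All.tail tails) (All.head tails) αp≢root
    rest≁p : All (_≁ p) (entries rest)
    rest≁p with ααp≁rest ∷ _ ← distinct =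
      All.map (λ ααp≁e e∼p → ααp≁e (∼-trans atTop (∼-sym e∼p))) ααp≁rest
    dropReturned : ∀ {h} → h ∉ p ∷ S → Any (_∼ h) (entries (α p ∷ rest)) → Any (_∼ h) (entries rest)
    dropReturned h∉ (here ααp∼h) = ⊥-elim (h∉ (returned-complete I (α-invol p) ααp∼h))
    dropReturned h∉ (there e∼h)  = e∼h
    unfinished′ : ∀ {g h} → g ∈ σ (α p) ∷ p ∷ S → h ∉ p ∷ S → g ∼ h → Any (_∼ h) (entries rest)
    unfinished′ (here refl) h∉ g∼h =
      dropReturned h∉ (unfinished (there αp∈S) (h∉ ∘ there) (∼-trans (∼-step (α p)) g∼h))
    unfinished′ (there g∈)  h∉ g∼h = dropReturned h∉ (unfinished g∈ (h∉ ∘ there) g∼h)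

  segment : ∀ {v} stk → Any (_∼ v) (entries stk) → List (Fin k)
  segment []      (here _)  = []
  segment (x ∷ s) (here _)  = []
  segment (x ∷ s) (there e) = segment s e ∷ʳ x

  segment-walk : ∀ {v} stk (e : Any (_∼ v) (entries stk)) → Linked stk → Walk v (segment stk e) (entry stk)
  segment-walk []      (here e∼v) _              = ∼-sym e∼v
  segment-walk (x ∷ s) (here e∼v) _              = ∼-sym e∼v
  segment-walk (x ∷ s) (there e)  (s∼x , linked) = walk-∷ʳ (segment s e) (segment-walk s e linked) s∼x

  segment-⊆ : ∀ {v} stk (e : Any (_∼ v) (entries stk)) → All (_∈ stk) (segment stk e)
  segment-⊆ []      (here _)  = []
  segment-⊆ (x ∷ s) (here _)  = []
  segment-⊆ (x ∷ s) (there e) = ++⁺ (All.map there (segment-⊆ s e)) (here refl ∷ [])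

  segment-distinct : ∀ {v} stk (e : Any (_∼ v) (entries stk)) → Linked stk → AllPairs _≁_ (entries stk) →
                     AllPairs _≁_ (segment stk e) ×
                     All (λ y → y ≁ entry stk × Any (_∼ y) (entries stk)) (segment stk e)
  segment-distinct []      (here _)  _              _                 = [] , []
  segment-distinct (x ∷ s) (here _)  _              _                 = [] , []
  segment-distinct (x ∷ s) (there e) (s∼x , linked) (αx≁s ∷ distinct)
    with pairwise , below ← segment-distinct s e linked distinct
    = AllPairs.++⁺ pairwise ([] ∷ []) (All.map (λ (y≁s , _) → y≁x y≁s ∷ []) below)
    , ++⁺ (All.map (λ (_ , at) → y≁αx at , there at) below)
          ((x≁αx , there (lose (entry-∈-entries s) s∼x)) ∷ [])
    where
    y≁x : ∀ {y} → y ≁ entry s → y ≁ x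
    y≁x y≁s y∼x = y≁s (∼-trans y∼x (∼-sym s∼x))
    y≁αx : ∀ {y} → Any (_∼ y) (entries s) → y ≁ α x
    y≁αx at y∼αx with e′ , e′∈ , e′∼y ← find at =
      All.lookup αx≁s e′∈ (∼-sym (∼-trans e′∼y y∼αx))
    x≁αx : x ≁ α x
    x≁αx x∼αx = All.lookup αx≁s (entry-∈-entries s) (∼-sym (∼-trans s∼x x∼αx))

  stack-cycle : ∀ {p S stk} → StackInv p S stk → Tail p → Any (_∼ α p) (entries stk) →
                ∃[ C ] (∀ {h} → InCycle O C h → ∃[ y ] y ∈ p ∷ stk × SameEdge y h)
  stack-cycle {p} {S} {stk} I tail-p e = cycleOfWalk p seg tails′ walk distinct′ , edges
    where
    open StackInv I
    seg : List (Fin k)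
    seg = segment stk e
    walk : Walk (α p) seg p
    walk = walk-extend seg (segment-walk stk e linked) atTop
    tails′ : All Tail (p ∷ seg)
    tails′ = tail-p ∷ All.map (All.lookup tails) (segment-⊆ stk e)
    distinct′ : AllPairs _≁_ (p ∷ seg)
    distinct′ with pairwise , below ← segment-distinct stk e linked distinct
      = All.map (λ (y≁top , _) p∼y → y≁top (∼-sym (∼-trans atTop p∼y))) below ∷ pairwise
    seg⊆stk : ∀ {y} → y ∈ p ∷ seg → y ∈ p ∷ stk
    seg⊆stk (here refl) = here refl
    seg⊆stk (there y∈)  = there (All.lookup (segment-⊆ stk e) y∈)
    edges : ∀ {h} → InCycle O (cycleOfWalk p seg tails′ walk distinct′) h →
            ∃[ y ] y ∈ p ∷ stk × SameEdge y h
    edges c with y , y∈ , same ← inCycle-cycleOfWalk tails′ walk distinct′ c = y , seg⊆stk y∈ , same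

  reachable-σ : ∀ {T h} → Star (TStep O T) root h → Star (TStep O T) root (σ h)
  reachable-σ {h = h} path = path ◅◅ inj₁ (∼-step h) ◅ ε

  reachable-∷ : ∀ {p T h} → Star (TStep O T) root h → Star (TStep O (p ∷ T)) root h
  reachable-∷ {p} {T} = gmap id widen
    where
    widen : ∀ {a b} → TStep O T a b → TStep O (p ∷ T) a b
    widen (inj₁ a∼b)                   = inj₁ a∼b
    widen (inj₂ (tail-a , a∈T , b≡αa)) = inj₂ (tail-a , inTree-there p {T} a∈T , b≡αa)

  record TreeInv (p : Fin k) (T S stk : List (Fin k)) : Set where
    field
      stackInTree     : All (InTree T) stk
      treeTailsSeen   : ∀ {h} → InTree T h → Tail h → h ∈ S
      seenTailsClosed : ∀ {h} → h ∈ S → Tail h → α h ∈ S ⊎ h ∈ stk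
      reachable       : ∀ {h} → h ∈ p ∷ S → Star (TStep O T) root h

  tree-init : TreeInv (σ root) [] [] []
  tree-init = record
    { stackInTree     = []
    ; treeTailsSeen   = λ ()
    ; seenTailsClosed = λ ()
    ; reachable       = λ { (here refl) → reachable-σ {[]} ε }
    }

  tree-cross : ∀ {p T S stk} → TreeInv p T S stk → Skipped S p → TreeInv (σ p) T (p ∷ S) stk
  tree-cross {p} {T} {S} {stk} I skipped = record
    { stackInTree     = stackInTree
    ; treeTailsSeen   = λ h∈T tail-h → there (treeTailsSeen h∈T tail-h)
    ; seenTailsClosed = closed
    ; reachable       = λ { (here refl) → reachable-σ {T} (reachable (here refl))
                          ; (there h∈)  → reachable h∈ }
    }
    where
    open TreeInv I
    closed : ∀ {h} → h ∈ p ∷ S → Tail h → α h ∈ p ∷ S ⊎ h ∈ stk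
    closed (here refl) tail-p = inj₁ (there (skipped-tail skipped tail-p))
    closed (there h∈S) tail-h = Sum.map₁ there (seenTailsClosed h∈S tail-h)

  tree-push : ∀ {p T S stk} → TreeInv p T S stk → Tail p → TreeInv (σ (α p)) (p ∷ T) (p ∷ S) (p ∷ stk)
  tree-push {p} {T} {S} {stk} I tail-p = record
    { stackInTree     = inTree-here p T ∷ All.map (inTree-there p {T}) stackInTree
    ; treeTailsSeen   = tailsSeen
    ; seenTailsClosed = closed
    ; reachable       = reach
    }
    where
    open TreeInv I
    tailsSeen : ∀ {h} → InTree (p ∷ T) h → Tail h → h ∈ p ∷ S
    tailsSeen {h} h∈ tail-h with inTree-∷⁻ {p} {T} {h} h∈
    ... | inj₁ (inj₁ refl) = here refl
    ... | inj₁ (inj₂ p≡αh) = ⊥-elim (tail≢head tail-p (subst Head (sym p≡αh) (head-of-α tail-h)))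
    ... | inj₂ h∈T         = there (treeTailsSeen h∈T tail-h)
    closed : ∀ {h} → h ∈ p ∷ S → Tail h → α h ∈ p ∷ S ⊎ h ∈ p ∷ stk
    closed (here refl) _      = inj₂ (here refl)
    closed (there h∈S) tail-h = Sum.map there there (seenTailsClosed h∈S tail-h)
    reach : ∀ {h} → h ∈ σ (α p) ∷ p ∷ S → Star (TStep O (p ∷ T)) root h
    reach (here refl) = reachable-σ {p ∷ T}
      (reachable-∷ {p} {T} (reachable (here refl)) ◅◅ inj₂ (tail-p , inTree-here p T , refl) ◅ ε)
    reach (there h∈)  = reachable-∷ {p} {T} (reachable h∈)

  tree-pop : ∀ {p T S rest} → TreeInv p T S (α p ∷ rest) → Tail (α p) → TreeInv (σ (α p)) T (p ∷ S) rest
  tree-pop {p} {T} {S} {rest} I tail-αp = record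
    { stackInTree     = All.tail stackInTree
    ; treeTailsSeen   = λ h∈T tail-h → there (treeTailsSeen h∈T tail-h)
    ; seenTailsClosed = closed
    ; reachable       = λ { (here refl) → reachable-σ {T} (reachable (there αp∈S))
                          ; (there h∈)  → reachable h∈ }
    }
    where
    open TreeInv I
    αp∈S : α p ∈ S
    αp∈S = treeTailsSeen (All.head stackInTree) tail-αp
    closed : ∀ {h} → h ∈ p ∷ S → Tail h → α h ∈ p ∷ S ⊎ h ∈ rest
    closed (here refl) tail-p = ⊥-elim (tail≢head tail-p (subst Head (α-invol p) (head-of-α tail-αp)))
    closed (there h∈S) tail-h with seenTailsClosed h∈S tail-h
    ... | inj₁ αh∈S           = inj₁ (there αh∈S)
    ... | inj₂ (here refl)    = inj₁ (here (α-invol p))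
    ... | inj₂ (there h∈rest) = inj₂ h∈rest

  TreeOrUnseen : List (Fin k) → List (Fin k) → DirCycle O → Set
  TreeOrUnseen T S C = ∀ {h} → InCycle O C h → InTree T h ⊎ (h ∉ S × α h ∉ S)

  treeOrUnseen-∷ : ∀ {T S q C} → TreeOrUnseen T (q ∷ S) C → TreeOrUnseen T S C
  treeOrUnseen-∷ ok c = Sum.map₂ (Product.map (_∘ there) (_∘ there)) (ok c)

  edge-unseen : ∀ {S y h} → y ∉ S → α y ∉ S → SameEdge y h → h ∉ S × α h ∉ S
  edge-unseen y∉S αy∉S (inj₁ refl) = y∉S , αy∉S
  edge-unseen {S} {h = h} y∉S αy∉S (inj₂ refl) = subst (_∉ S) (α-invol h) αy∉S , y∉S

  -- The tour walks from the root corner to the corner before its current half-edge crossing only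
  -- met half-edges of edges not in T, so it crosses no cycle made of edges of T and unmet edges.
  CornerInv : Fin k → List (Fin k) → List (Fin k) → Set
  CornerInv p T S = ∀ C → TreeOrUnseen T S C → RootCornerPath C (σ⁻¹ p)

  corners-init : CornerInv (σ root) [] []
  corners-init C _ = subst (RootCornerPath C) (sym (σ⁻¹σ root)) ε

  corners-cross : ∀ {p T S} → CornerInv p T S → edgeInᵇ O T p ≡ false → CornerInv (σ p) T (p ∷ S)
  corners-cross {p} {T} {S} I p∉T C ok = corner-cross C p∉C (I C (treeOrUnseen-∷ {T} {S} {p} {C} ok))
    where
    p∉C : ¬ InCycle O C p
    p∉C c with ok c
    ... | inj₁ p∈T with () ← trans (sym p∈T) p∉T
    ... | inj₂ (p∉ , _) = p∉ (here refl)

  corners-push : ∀ {p T S} → CornerInv p T S → p ∉ S → α p ∉ S → CornerInv (σ (α p)) (p ∷ T) (p ∷ S)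
  corners-push {p} {T} {S} I p∉S αp∉S C ok = corner-follow C (I C ok′)
    where
    ok′ : TreeOrUnseen T S C
    ok′ c with ok c
    ... | inj₂ (h∉ , αh∉) = inj₂ (h∉ ∘ there , αh∉ ∘ there)
    ... | inj₁ h∈p∷T with inTree-∷⁻ {p} {T} h∈p∷T
    ...   | inj₁ same = inj₂ (edge-unseen p∉S αp∉S same)
    ...   | inj₂ h∈T  = inj₁ h∈T

  corners-pop : ∀ {p T S} → CornerInv p T S → CornerInv (σ (α p)) T (p ∷ S)
  corners-pop {p} {T} {S} I C ok = corner-follow C (I C (treeOrUnseen-∷ {T} {S} {p} {C} ok))

  record Invariant (p : Fin k) (T S stk : List (Fin k)) : Set where
    field
      stack   : StackInv p S stk
      tree    : TreeInv p T S stk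
      corners : CornerInv p T S
    open StackInv stack public
    open TreeInv tree public

  -- Were the vertex of α p touched, it would be on the stack, and p followed by the stack edges
  -- above that vertex would be a directed cycle with the root corner on its right.
  fresh-vertex : (∀ C → ¬ Positive O C) → ∀ {p T S stk} → Invariant p T S stk → Tail p → α p ∉ S →
                 ∀ {g} → g ∈ p ∷ S → g ≁ α p
  fresh-vertex noPositive {p} {T} {S} {stk} I tail-p αp∉S g∈ g∼αp = noPositive C (corners C treeOrUnseen)
    where
    open Invariant I
    cycle : ∃[ C ] (∀ {h} → InCycle O C h → ∃[ y ] y ∈ p ∷ stk × SameEdge y h)
    cycle = stack-cycle stack tail-p (unfinished g∈ αp∉S g∼αp)
    C : DirCycle O
    C = proj₁ cycle
    onStack : ∀ {y h} → y ∈ p ∷ stk → SameEdge y h → InTree T h ⊎ (h ∉ S × α h ∉ S)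
    onStack (here refl)   same = inj₂ (edge-unseen (firstUnseen-∉ current) αp∉S same)
    onStack (there y∈stk) same = inj₁ (inTree-sameEdge {T} (All.lookup stackInTree y∈stk) same)
    treeOrUnseen : TreeOrUnseen T S C
    treeOrUnseen c with y , y∈ , same ← proj₂ cycle c = onStack y∈ same

  follow-pops : ∀ {p T S stk} → Invariant p T S stk → InTree T p → ∃[ rest ] stk ≡ α p ∷ rest
  follow-pops {p} {T} {S} {stk} I p∈T = onTop stk distinct atTop αp∈stk
    where
    open Invariant I
    p∉S : p ∉ S
    p∉S = firstUnseen-∉ current
    head-p : Head p
    head-p with tail-or-head p
    ... | inj₁ tail-p = ⊥-elim (p∉S (treeTailsSeen p∈T tail-p))
    ... | inj₂ head-p = head-p
    αp∈stk : α p ∈ stk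
    αp∈stk with seenTailsClosed (treeTailsSeen (inTree-α {T} p∈T) (tail-of-α head-p)) (tail-of-α head-p)
    ... | inj₁ ααp∈S  = ⊥-elim (p∉S (subst (_∈ S) (α-invol p) ααp∈S))
    ... | inj₂ αp∈stk = αp∈stk
    onTop : ∀ s → AllPairs _≁_ (entries s) → entry s ∼ p → α p ∈ s → ∃[ rest ] s ≡ α p ∷ rest
    onTop (y ∷ s) _          _    (here refl)  = s , refl
    onTop (y ∷ s) (αy≁s ∷ _) αy∼p (there αp∈s) =
      ⊥-elim (All.lookup αy≁s (subst (_∈ entries s) (α-invol p) (α-∈-entries αp∈s)) αy∼p)

  offTree-∉-entries : ∀ {p T} stk → All (InTree T) stk → edgeInᵇ O T p ≡ false → p ≢ root →
                      p ∉ entries stk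
  offTree-∉-entries []      _ _ p≢root (here p≡root) = p≢root p≡root
  offTree-∉-entries {p} {T} (x ∷ s) (x∈T ∷ _) p∉T _ (here p≡αx)
    with () ← trans (sym (trans (cong (edgeInᵇ O T) p≡αx) (inTree-α {T} x∈T))) p∉T
  offTree-∉-entries {T = T} (x ∷ s) (_ ∷ s⊆T) p∉T p≢root (there p∈s) =
    offTree-∉-entries {T = T} s s⊆T p∉T p≢root p∈s

  invariant-init : Invariant (σ root) [] [] []
  invariant-init = record { stack = stack-init ; tree = tree-init ; corners = corners-init }

  invariant-cross : ∀ {p T S stk} → Invariant p T S stk → edgeInᵇ O T p ≡ false → Skipped S p → p ≢ root →
                    Invariant (σ p) T (p ∷ S) stk
  invariant-cross {T = T} {stk = stk} I p∉T skipped p≢root = record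
    { stack   = stack-cross stack (offTree-∉-entries {T = T} stk stackInTree p∉T p≢root)
    ; tree    = tree-cross tree skipped
    ; corners = corners-cross {T = T} corners p∉T
    }
    where open Invariant I

  invariant-push : (∀ C → ¬ Positive O C) → ∀ {p T S stk} → Invariant p T S stk → Tail p → α p ∉ S →
                   Invariant (σ (α p)) (p ∷ T) (p ∷ S) (p ∷ stk)
  invariant-push noPositive {T = T} I tail-p αp∉S = record
    { stack   = stack-push stack tail-p (fresh-vertex noPositive I tail-p αp∉S)
    ; tree    = tree-push tree tail-p
    ; corners = corners-push {T = T} corners (firstUnseen-∉ current) αp∉S
    }
    where open Invariant I

  invariant-pop : ∀ {p T S rest} → Invariant p T S (α p ∷ rest) → α p ≢ root →
                  Invariant (σ (α p)) T (p ∷ S) rest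
  invariant-pop {T = T} I αp≢root = record
    { stack   = stack-pop stack (treeTailsSeen (All.head stackInTree) (All.head tails)) αp≢root
    ; tree    = tree-pop tree (All.head tails)
    ; corners = corners-pop {T = T} corners
    }
    where open Invariant I

  record Complete (T S : List (Fin k)) : Set where
    field
      allSeen      : ∀ h → h ∈ S
      allReachable : ∀ h → Star (TStep O T) root h

  -- The run of γ

  module Run (treeOriented : TreeOriented O) where

    noPositive : ∀ C → ¬ Positive O C
    noPositive = proj₁ treeOriented

    closure-contains-all : ∀ {V} → root ∈ V → (∀ {a b} → a ∈ V → DStep O a b → b ∈ V) → ∀ h → h ∈ V
    closure-contains-all {V} root∈V closed h =
      foldl (λ a b → a ∈ V → b ∈ V) (λ a⇒b b→c a∈V → closed (a⇒b a∈V) b→c) id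
            (proj₂ treeOriented h) root∈V

    completion : ∀ {p T S stk} → Invariant p T S stk → root ∈ p ∷ S →
                 All (λ e → ∀ {h} → e ∼ h → h ∈ p ∷ S) (entries stk) →
                 (∀ {a} → a ∈ p ∷ S → Tail a → α a ∈ p ∷ S) → Complete T (p ∷ S)
    completion {p} {T} {S} {stk} I root∈ finished tailsClosed = record
      { allSeen      = allSeen
      ; allReachable = λ h → reachable (allSeen h)
      }
      where
      open Invariant I
      closed : ∀ {a b} → a ∈ p ∷ S → DStep O a b → b ∈ p ∷ S
      closed {b = b} a∈ (inj₁ a∼b) with b ∈? p ∷ S
      ... | yes b∈ = b∈
      ... | no b∉ with e , e∈ , e∼b ← find (unfinished a∈ (b∉ ∘ there) a∼b) =
        ⊥-elim (b∉ (All.lookup finished e∈ e∼b))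
      closed a∈ (inj₂ (tail-a , refl)) = tailsClosed a∈ tail-a
      allSeen : ∀ h → h ∈ p ∷ S
      allSeen = closure-contains-all root∈ closed

    final-cross : ∀ {T S} stk → Invariant root T S stk → Skipped S root → Complete T (root ∷ S)
    final-cross (x ∷ s) I _ = ⊥-elim (root-below (Invariant.distinct I) (Invariant.atTop I))
    final-cross {T} {S} [] I skipped = completion I (here refl) (returned-complete stack refl ∷ []) closed
      where
      open Invariant I
      closed : ∀ {a} → a ∈ root ∷ S → Tail a → α a ∈ root ∷ S
      closed (here refl) tail-root = there (skipped-tail skipped tail-root)
      closed (there a∈S) tail-a with seenTailsClosed a∈S tail-a
      ... | inj₁ αa∈S = there αa∈S

    -- γ also stops when it comes back along the root edge, if that was the last edge added to T.
    final-pop : ∀ {p T S} rest → Invariant p T S (α p ∷ rest) → α p ≡ root → Complete T (p ∷ S)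
    final-pop (y ∷ r) I αp≡root = ⊥-elim
      (root-below (AllPairs.tail (Invariant.distinct I)) (subst (_ ∼_) αp≡root (proj₁ (Invariant.linked I))))
    final-pop {p} {T} {S} [] I αp≡root = completion I root∈ finished closed
      where
      open Invariant I
      root∈ : root ∈ p ∷ S
      root∈ = there (subst (_∈ S) αp≡root (treeTailsSeen (All.head stackInTree) (All.head tails)))
      finished : All (λ e → ∀ {h} → e ∼ h → h ∈ p ∷ S) (α (α p) ∷ root ∷ [])
      finished = returned-complete stack (α-invol p) ∷ (there ∘ lastSeen-return rootArc) ∷ []
        where
        rootArc : LastSeenAfter S root root
        rootArc = subst (LastSeenAfter S root) αp≡root (proj₁ suspended)
      closed : ∀ {a} → a ∈ p ∷ S → Tail a → α a ∈ p ∷ S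
      closed (here refl) tail-p = ⊥-elim (tail≢head tail-p (subst Head (α-invol p) (head-of-α (All.head tails))))
      closed (there a∈S) tail-a with seenTailsClosed a∈S tail-a
      ... | inj₁ αa∈S        = there αa∈S
      ... | inj₂ (here refl) = here (α-invol p)

    push-to-root-impossible : ∀ {p T S stk} → Invariant p T S stk → Tail p → α p ∉ S → α p ≢ root
    push-to-root-impossible {stk = stk} I tail-p αp∉S αp≡root
      with g , g∈ , g∼root ← All.lookup (Invariant.visited I) (root-∈-entries stk)
      = fresh-vertex noPositive I tail-p αp∉S g∈ (subst (_ ∼_) (sym αp≡root) g∼root)

    Good : γState O → Set
    Good (st p T S false) = ∃[ stk ] Invariant p T S stk
    Good (st p T S true)  = Complete T S

    good-after : ∀ {p T S stk s} → Invariant p T S stk → Step p T S s → Good s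
    good-after {p} {stk = stk} I (cross p∉T skipped) with p ≟ root
    ... | yes refl  = final-cross stk I skipped
    ... | no p≢root = stk , invariant-cross I p∉T skipped p≢root
    good-after {p} {stk = stk} I (push tail-p αp∉S) with α p ≟ root
    ... | yes αp≡root = ⊥-elim (push-to-root-impossible I tail-p αp∉S αp≡root)
    ... | no _        = p ∷ stk , invariant-push noPositive I tail-p αp∉S
    good-after {p} I (follow p∈T _) with follow-pops I p∈T | α p ≟ root
    ... | rest , refl | yes αp≡root = final-pop rest I αp≡root
    ... | rest , refl | no αp≢root  = rest , invariant-pop I αp≢root

    good-step : ∀ s → Good s → Good (γstep O s)
    good-step (st p T S true)  complete = complete
    good-step (st p T S false) (_ , I)  = good-after I (step p T S)

    open γState

    running-invariant : ∀ s → Good s → done s ≡ false → ∃[ stk ] Invariant (pos s) (tree s) (seen s) stk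
    running-invariant (st p T S false) good refl = good

    finished-complete : ∀ s → Good s → done s ≡ true → Complete (tree s) (seen s)
    finished-complete (st p T S true) good refl = good

    pos-unseen : ∀ s → Good s → done s ≡ false → pos s ∉ seen s
    pos-unseen s good running = firstUnseen-∉ (Invariant.current (proj₂ (running-invariant s good running)))

    done-step : ∀ s → done s ≡ true → done (γstep O s) ≡ true
    done-step (st p T S true) refl = refl

    seen-step : ∀ s {h} → h ∈ seen (γstep O s) → h ∈ seen s ⊎ (done s ≡ false × pos s ≡ h)
    seen-step (st p T S true)  h∈S         = inj₁ h∈S
    seen-step (st p T S false) (here h≡p)  = inj₂ (refl , sym h≡p)
    seen-step (st p T S false) (there h∈S) = inj₁ h∈S

    seen-grows : ∀ s {h} → h ∈ seen s → h ∈ seen (γstep O s)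
    seen-grows (st p T S true)  h∈S = h∈S
    seen-grows (st p T S false) h∈S = there h∈S

    pos-seen-next : ∀ s → done s ≡ false → pos s ∈ seen (γstep O s)
    pos-seen-next (st p T S false) refl = here refl

    pos-step : ∀ s → done s ≡ false → pos (γstep O s) ≡ tourNext O (tree (γstep O s)) (pos s)
    pos-step (st p T S false) refl = refl

    -- An edge added to T has both half-edges unmet, so it is not the edge of a half-edge met before.
    edgeIn-settled : ∀ s → Good s → ∀ {h} → h ∈ seen s →
                     edgeInᵇ O (tree (γstep O s)) h ≡ edgeInᵇ O (tree s) h
    edgeIn-settled (st p T S true)  _       _         = refl
    edgeIn-settled (st p T S false) (_ , I) {h} h∈S = settled (step p T S)
      where
      settled : ∀ {s} → Step p T S s → edgeInᵇ O (tree s) h ≡ edgeInᵇ O T h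
      settled (cross _ _)   = refl
      settled (follow _ _)  = refl
      settled (push _ αp∉S) = edgeIn-∷-≢ T
        (λ p≡h → firstUnseen-∉ (Invariant.current I) (subst (_∈ S) (sym p≡h) h∈S))
        (λ p≡αh → αp∉S (subst (_∈ S) (trans (sym (α-invol h)) (cong α (sym p≡αh))) h∈S))

    skipped-step : ∀ s → done s ≡ false → Tail (pos s) → edgeInᵇ O (tree (γstep O s)) (pos s) ≡ false →
                   α (pos s) ∈ seen s
    skipped-step (st p T S false) refl tail-p = notPushed (step p T S)
      where
      notPushed : ∀ {s} → Step p T S s → edgeInᵇ O (tree s) p ≡ false → α p ∈ S
      notPushed (cross _ skipped)  _ = skipped-tail skipped tail-p
      notPushed (follow _ skipped) _ = skipped-tail skipped tail-p
      notPushed (push _ _) p∉p∷T with () ← trans (sym (inTree-here p T)) p∉p∷T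

    run : ℕ → γState O
    run i = iter (γstep O) i (γinit O)

    good : ∀ i → Good (run i)
    good zero    = [] , invariant-init
    good (suc i) = good-step (run i) (good i)

    done-upward : ∀ {i j} → i ≤ j → done (run i) ≡ true → done (run j) ≡ true
    done-upward = ≤-upward (λ n → done-step (run n))

    running-downward : ∀ {i j} → i ≤ j → done (run j) ≡ false → done (run i) ≡ false
    running-downward {i} i≤j running with done (run i) in finished
    ... | false = refl
    ... | true with () ← trans (sym (done-upward i≤j finished)) running

    seen-upward : ∀ {h i j} → i ≤ j → h ∈ seen (run i) → h ∈ seen (run j)
    seen-upward = ≤-upward (λ n → seen-grows (run n))

    settled-upward : ∀ {h i j} → i ≤ j → h ∈ seen (run i) →
                     edgeInᵇ O (tree (run j)) h ≡ edgeInᵇ O (tree (run i)) h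
    settled-upward {h} {i} i≤j h∈ = proj₂ (≤-upward {Settled} next i≤j (h∈ , refl))
      where
      Settled : ℕ → Set
      Settled n = h ∈ seen (run n) × edgeInᵇ O (tree (run n)) h ≡ edgeInᵇ O (tree (run i)) h
      next : ∀ n → Settled n → Settled (suc n)
      next n (h∈n , eq) = seen-grows (run n) h∈n , trans (edgeIn-settled (run n) (good n) h∈n) eq

    visited-at : ∀ {h} j → h ∈ seen (run j) → ∃[ i ] i < j × done (run i) ≡ false × pos (run i) ≡ h
    visited-at (suc j) h∈ with seen-step (run j) h∈
    ... | inj₂ (running , pos≡h) = j , n<1+n j , running , pos≡h
    ... | inj₁ h∈j with i , i<j , running , pos≡h ← visited-at j h∈j = i , m<n⇒m<1+n i<j , running , pos≡h

    visited-later : ∀ {i j} → i < j → done (run i) ≡ false → pos (run i) ∈ seen (run j)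
    visited-later {i} i<j running = seen-upward i<j (pos-seen-next (run i) running)

    positions-distinct : ∀ {i j} → i < j → done (run j) ≡ false → pos (run i) ≢ pos (run j)
    positions-distinct {i} {j} i<j running eq = pos-unseen (run j) (good j) running
      (subst (_∈ seen (run j)) eq (visited-later i<j (running-downward (<⇒≤ i<j) running)))

    halts : done (run k) ≡ true
    halts with done (run k) in finished
    ... | true  = refl
    ... | false with i , j , i<j , eq ← pigeonhole (n<1+n k) (λ i → pos (run (toℕ i)))
      = ⊥-elim (positions-distinct i<j (running-downward (toℕ≤pred[n] j) finished) eq)

    running-before-halt : ∀ i → done (run i) ≡ false → i < k
    running-before-halt i running with i <? k
    ... | yes i<k = i<k
    ... | no i≮k with () ← trans (sym (done-upward (≮⇒≥ i≮k) halts)) running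

    final : Complete (γ O) (seen (run k))
    final = finished-complete (run k) (good k) halts

    γ-settled : ∀ i → done (run i) ≡ false →
                edgeInᵇ O (γ O) (pos (run i)) ≡ edgeInᵇ O (tree (run (suc i))) (pos (run i))
    γ-settled i running = settled-upward (running-before-halt i running) (pos-seen-next (run i) running)

    tour-follows-run : ∀ i → done (run i) ≡ false → tourPos O (γ O) i ≡ pos (run i)
    tour-follows-run zero    _       = refl
    tour-follows-run (suc i) running = begin
      tourNext O (γ O) (tourPos O (γ O) i)          ≡⟨ cong (tourNext O (γ O)) (tour-follows-run i runningᵢ) ⟩
      tourNext O (γ O) (pos (run i))                ≡⟨ cong (λ b → σ (if b then α (pos (run i)) else pos (run i)))
                                                            (γ-settled i runningᵢ) ⟩
      tourNext O (tree (run (suc i))) (pos (run i)) ≡⟨ pos-step (run i) runningᵢ ⟨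
      pos (run (suc i))                             ∎
      where
      open ≡-Reasoning
      runningᵢ : done (run i) ≡ false
      runningᵢ = running-downward (n≤1+n i) running

    away-from-root : OrientedAwayFromRoot O (γ O)
    away-from-root t _ _ = Complete.allReachable final t

    head-seen-first : ∀ {h} j → done (run j) ≡ false → pos (run j) ≡ α h → Head h →
                      edgeInᵇ O (γ O) h ≡ false → h ∈ seen (run j)
    head-seen-first {h} j running posⱼ≡αh head-h h∉γ =
      subst (_∈ seen (run j)) (trans (cong α posⱼ≡αh) (α-invol h))
        (skipped-step (run j) running (subst Tail (sym posⱼ≡αh) (tail-of-α head-h)) αh∉tree)
      where
      αh∉tree : edgeInᵇ O (tree (run (suc j))) (pos (run j)) ≡ false
      αh∉tree = begin
        edgeInᵇ O (tree (run (suc j))) (pos (run j)) ≡⟨ γ-settled j running ⟨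
        edgeInᵇ O (γ O) (pos (run j))                ≡⟨ cong (edgeInᵇ O (γ O)) posⱼ≡αh ⟩
        edgeInᵇ O (γ O) (α h)                        ≡⟨ edgeIn-α (γ O) h ⟩
        edgeInᵇ O (γ O) h                            ≡⟨ h∉γ ⟩
        false                                        ∎
        where open ≡-Reasoning

    nontree-head-first : NonTreeHeadFirst O (γ O)
    nontree-head-first h h∉γ head-h
      with j , j<k , runningⱼ , posⱼ≡αh ← visited-at k (Complete.allSeen final (α h))
      with i , i<j , runningᵢ , posᵢ≡h ← visited-at j (head-seen-first j runningⱼ posⱼ≡αh head-h h∉γ)
      = i , j , i<j , j<k
      , trans (tour-follows-run i runningᵢ) posᵢ≡h
      , trans (tour-follows-run j runningⱼ) posⱼ≡αh
      , λ l l<j tourₗ≡αh → positions-distinct l<j runningⱼ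
          (trans (sym (tour-follows-run l (running-downward (<⇒≤ l<j) runningⱼ)))
                 (trans tourₗ≡αh (sym posⱼ≡αh)))

lemma3 : (O : OrientedMap) → TreeOriented O →
    OrientedAwayFromRoot O (γ O) × NonTreeHeadFirst O (γ O)
lemma3 O treeOriented = away-from-root , nontree-head-first
  where open Traversal.Run O treeOriented
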